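{- Let $G=(V,E)$ be a graph satisfying the triangle condition, let $L$ be a consensus function on $G$ satisfying the axioms (A), (B), (C), (T), and let $\pi$ be any profile. For every edge $uv$ of $G$: (1) if $F_\pi(u)=F_\pi(v)$, then $u\in L(\pi)$ if and only if $v\in L(\pi)$; (2) if $F_\pi(u)>F_\pi(v)$, then $u\notin L(\pi)$.
   Context: Graphs are undirected, simple and connected; $d$ is the distance, $I(u,v)=\{w:d(u,w)+d(w,v)=d(u,v)\}$. $G$ satisfies the triangle condition if for all vertices $u,v,w$ with $1=d(v,w)<d(u,v)=d(u,w)$ there is a common neighbor $x$ of $v,w$ with $d(u,x)=d(u,v)-1$. A profile is a finite sequence $\pi=(x_1,\dots,x_n)$ of vertices (repetitions allowed), $V^*$ the set of profiles, $\pi\rho$ concatenation; $F_\pi(v)=\sum_i d(v,x_i)$. A consensus function is a map $L:V^*\to 2^V\setminus\{\emptyset\}$. Axioms: (A) invariance under permutations of the profile; (B) $L(u,v)=I(u,v)$; (C) if $L(\pi)\cap L(\rho)\neq\emptyset$ then $L(\pi\rho)=L(\pi)\cap L(\rho)$; (T) for any three pairwise adjacent vertices $u,v,w$, $L(u,v,w)=\{u,v,w\}$. -}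

module Defs where

open import Data.Nat using (ℕ; zero; suc; _+_; _∸_; _≤_; _<_; _>_)
open import Data.List using (List; []; _∷_; _++_; map)
open import Data.Nat.ListAction using (sum)
open import Data.List.Relation.Binary.Permutation.Propositional using (_↭_)
open import Data.Product using (Σ; ∃; _×_; _,_)
open import Data.Sum using (_⊎_)
open import Relation.Nullary using (¬_)
open import Relation.Binary.PropositionalEquality using (_≡_)

data Walk {V : Set} (_~_ : V → V → Set) : V → V → ℕ → Set where
  here : ∀ {u} → Walk _~_ u u zero
  step : ∀ {u w v k} → u ~ w → Walk _~_ w v k → Walk _~_ u v (suc k)

-- An (undirected, simple, connected) graph, possibly infinite, together with
-- its graph distance d: d u v is the length of a shortest u–v walk
-- (existence of such a walk for all u, v is connectedness).
record Graph : Set₁ where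
  field
    V      : Set
    _~_    : V → V → Set
    ~-sym  : ∀ {u v} → u ~ v → v ~ u
    ~-irr  : ∀ {u} → ¬ (u ~ u)
    d      : V → V → ℕ
    d-walk : ∀ u v → Walk _~_ u v (d u v)
    d-min  : ∀ u v k → Walk _~_ u v k → d u v ≤ k

module _ (G : Graph) where
  open Graph G

  I : V → V → V → Set
  I u v w = d u w + d w v ≡ d u v

  TriangleCondition : Set
  TriangleCondition = ∀ u v w → d v w ≡ 1 → d u v > d v w → d u v ≡ d u w →
    Σ V λ x → (x ~ v) × (x ~ w) × (d u x ≡ d u v ∸ 1)

  Profile : Set
  Profile = List V

  F : Profile → V → ℕ
  F π v = sum (map (d v) π)

  _≐_ : (V → Set) → (V → Set) → Set
  A ≐ B = (∀ x → A x → B x) × (∀ x → B x → A x)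

  _∩_ : (V → Set) → (V → Set) → (V → Set)
  (A ∩ B) x = A x × B x

  record ConsensusFunction : Set₁ where
    field
      L        : Profile → V → Set
      nonempty : ∀ π → ∃ λ x → L π x

  module _ (C : ConsensusFunction) where
    open ConsensusFunction C

    AxiomA : Set
    AxiomA = ∀ π ρ → π ↭ ρ → L π ≐ L ρ

    AxiomB : Set
    AxiomB = ∀ u v → L (u ∷ v ∷ []) ≐ I u v

    AxiomC : Set
    AxiomC = ∀ π ρ → (∃ λ x → (L π ∩ L ρ) x) → L (π ++ ρ) ≐ (L π ∩ L ρ)

    AxiomT : Set
    AxiomT = ∀ u v w → u ~ v → v ~ w → u ~ w →
      L (u ∷ v ∷ w ∷ []) ≐ (λ x → (x ≡ u) ⊎ (x ≡ v) ⊎ (x ≡ w))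

{-# OPTIONS --safe #-}
-- Pair every voter y with v, with u and v, or with u, according as y is
-- nearer to u, equidistant, or nearer to v; each such small profile has both u and v in its
-- consensus (for the equidistant voter this is where (T) and the triangle condition enter).
-- By consistency, u and v then both lie in L(π ++ u^(m+1) v^(n+1)) with F π u + n = F π v + m.
-- If u ∈ L π, consistency makes this set L π ∩ L(u^(m+1) v^(n+1)): for m = n that forces
-- v ∈ L π, while F π u > F π v gives m > n, where L(u^(m+1) v^(n+1)) = {u} excludes v.
module Submission where

open import Defs
open import Data.Nat using (ℕ; zero; suc; _+_; _∸_; _≤_; _<_; _>_; z≤n; s≤s)
open import Data.Nat.Properties
open import Data.List using (List; []; _∷_; _++_; replicate)
import Data.List.Properties as List
open import Data.List.Relation.Binary.Permutation.Propositional
  using (_↭_; prep; swap; ↭-refl; ↭-sym; ↭-trans; ↭-reflexive)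
open import Data.List.Relation.Binary.Permutation.Propositional.Properties using (shift; ++⁺ˡ)
open import Data.Product using (∃; ∃₂; _×_; _,_; proj₁; proj₂)
open import Function using (_∘′_)
import Algebra.Properties.CommutativeSemigroup as CommutativeSemigroupProperties
open import Data.Sum using (inj₁; inj₂)
open import Data.Empty using (⊥-elim)
open import Relation.Nullary using (¬_)
open import Relation.Binary using (tri<; tri≈; tri>)
open import Relation.Binary.PropositionalEquality
  using (_≡_; refl; sym; trans; cong; cong₂; subst; subst₂; module ≡-Reasoning)

module _ {V : Set} {_~_ : V → V → Set} where

  _▷_ : ∀ {u w v k} → Walk _~_ u w k → w ~ v → Walk _~_ u v (suc k)
  here     ▷ e = step e here
  step f p ▷ e = step f (p ▷ e)

  _++ʷ_ : ∀ {u w v m n} → Walk _~_ u w m → Walk _~_ w v n → Walk _~_ u v (m + n)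
  here     ++ʷ q = q
  step e p ++ʷ q = step e (p ++ʷ q)

  reverseʷ : (∀ {u v} → u ~ v → v ~ u) → ∀ {u v k} → Walk _~_ u v k → Walk _~_ v u k
  reverseʷ sym~ here       = here
  reverseʷ sym~ (step e p) = reverseʷ sym~ p ▷ sym~ e

+-interchange-≡ : ∀ p q r s {a b m n} → p + b ≡ q + a → r + n ≡ s + m →
                  (p + r) + (b + n) ≡ (q + s) + (a + m)
+-interchange-≡ p q r s {a} {b} {m} {n} e₁ e₂ =
  trans (interchange p r b n) (trans (cong₂ _+_ e₁ e₂) (interchange q a s m))
  where open CommutativeSemigroupProperties +-commutativeSemigroup using (interchange)

module Blocks {A : Set} (u v : A) where

  block : ℕ → ℕ → List A
  block m n = replicate m u ++ replicate n v

  block-absorb : ∀ a b ρ m n → block a b ++ ρ ++ block m n ↭ ρ ++ block (a + m) (b + n)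
  block-absorb zero    zero    ρ m n = ↭-refl
  block-absorb zero    (suc b) ρ m n =
    ↭-trans (prep v (block-absorb zero b ρ m n))
      (↭-trans (↭-sym (shift v ρ _)) (++⁺ˡ ρ (↭-sym (shift v (replicate m u) _))))
  block-absorb (suc a) b       ρ m n =
    ↭-trans (prep u (block-absorb a b ρ m n)) (↭-sym (shift u ρ _))

module Distance (G : Graph) where
  open Graph G

  d-sym : ∀ a b → d a b ≡ d b a
  d-sym a b = ≤-antisym (d-min a b _ (reverseʷ ~-sym (d-walk b a)))
                        (d-min b a _ (reverseʷ ~-sym (d-walk a b)))

  d-triangle : ∀ a b c → d a c ≤ d a b + d b c
  d-triangle a b c = d-min a c _ (d-walk a b ++ʷ d-walk b c)

  d-refl : ∀ a → d a a ≡ 0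
  d-refl a = n≤0⇒n≡0 (d-min a a 0 here)

  d≡0⇒≡ : ∀ {a b} → d a b ≡ 0 → a ≡ b
  d≡0⇒≡ {a} {b} e with subst (Walk _~_ a b) e (d-walk a b)
  ... | here = refl

  d≡1⇒~ : ∀ {a b} → d a b ≡ 1 → a ~ b
  d≡1⇒~ {a} {b} e with subst (Walk _~_ a b) e (d-walk a b)
  ... | step a~b here = a~b

  ~⇒d≡1 : ∀ {a b} → a ~ b → d a b ≡ 1
  ~⇒d≡1 {a} {b} a~b with d a b in e | d-min a b 1 (step a~b here)
  ... | zero        | _      = ⊥-elim (~-irr (subst (a ~_) (sym (d≡0⇒≡ e)) a~b))
  ... | suc zero    | _      = refl
  ... | suc (suc _) | s≤s ()

  a∈I : ∀ {a b} → I G a b a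
  a∈I {a} {b} = cong (_+ d a b) (d-refl a)

  b∈I : ∀ {a b} → I G a b b
  b∈I {a} {b} = trans (cong (d a b +_) (d-refl b)) (+-identityʳ (d a b))

  I-sym : ∀ {a b t} → I G a b t → I G b a t
  I-sym {a} {b} {t} e = begin
    d b t + d t a ≡⟨ cong₂ _+_ (d-sym b t) (d-sym t a) ⟩
    d t b + d a t ≡⟨ +-comm (d t b) (d a t) ⟩
    d a t + d t b ≡⟨ e ⟩
    d a b         ≡⟨ d-sym a b ⟩
    d b a         ∎
    where open ≡-Reasoning

  closer-∈I : ∀ {z w a} → w ~ a → suc (d z w) ≡ d z a → I G z a w
  closer-∈I {z} {w} {a} w~a e =
    trans (cong (d z w +_) (~⇒d≡1 w~a)) (trans (+-comm (d z w) 1) e)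

  nearer-∈I : ∀ {a b z} → a ~ b → d z a < d z b → I G z b a
  nearer-∈I {a} {b} {z} a~b lt =
    closer-∈I a~b (≤-antisym lt (≤-trans (d-triangle z a b) (≤-reflexive one-step)))
    where
    one-step : d z a + d a b ≡ suc (d z a)
    one-step = trans (cong (d z a +_) (~⇒d≡1 a~b)) (+-comm (d z a) 1)

  nearer-+1 : ∀ {a b z} → a ~ b → d z a < d z b → d a z + 1 ≡ d b z
  nearer-+1 {a} {b} {z} a~b lt = begin
    d a z + 1     ≡⟨ cong₂ _+_ (d-sym a z) (sym (~⇒d≡1 a~b)) ⟩
    d z a + d a b ≡⟨ nearer-∈I a~b lt ⟩
    d z b         ≡⟨ d-sym z b ⟩
    d b z         ∎
    where open ≡-Reasoning

  closer-common-neighbour : TriangleCondition G → ∀ {a b z} → a ~ b → d z a ≡ d z b →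
                            ∃ λ w → w ~ a × w ~ b × suc (d z w) ≡ d z a
  closer-common-neighbour tc {a} {b} {z} a~b eq = by-distance (d z a) refl
    where
    by-distance : ∀ k → d z a ≡ k → ∃ λ w → w ~ a × w ~ b × suc (d z w) ≡ d z a
    by-distance zero e =
      ⊥-elim (~-irr (subst (a ~_) (trans (sym (d≡0⇒≡ (trans (sym eq) e))) (d≡0⇒≡ e)) a~b))
    by-distance (suc zero) e =
      z , d≡1⇒~ e , d≡1⇒~ (trans (sym eq) e) , trans (cong suc (d-refl z)) (sym e)
    by-distance (suc (suc k)) e
      with tc z a b (~⇒d≡1 a~b) (subst₂ _<_ (sym (~⇒d≡1 a~b)) (sym e) (s≤s (s≤s z≤n))) eq
    ... | w , w~a , w~b , dzw =
      w , w~a , w~b , trans (cong suc dzw) (trans (cong (λ t → suc (t ∸ 1)) e) (sym e))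

module Consensus (G : Graph) (C : ConsensusFunction G) where
  open Graph G
  open ConsensusFunction C
  open Distance G

  module Anonymity (axA : AxiomA G C) where

    L-↭ : ∀ {π ρ t} → π ↭ ρ → L π t → L ρ t
    L-↭ {π} {ρ} {t} π↭ρ = proj₁ (axA π ρ π↭ρ) t

  module Consistency (axC : AxiomC G C) where

    L-++⁺ : ∀ {π ρ t} → L π t → L ρ t → L (π ++ ρ) t
    L-++⁺ {π} {ρ} {t} tπ tρ = proj₂ (axC π ρ (t , tπ , tρ)) t (tπ , tρ)

    L-++⁻ˡ : ∀ {π ρ t s} → L π t → L ρ t → L (π ++ ρ) s → L π s
    L-++⁻ˡ {π} {ρ} {t} {s} tπ tρ = proj₁ ∘′ proj₁ (axC π ρ (t , tπ , tρ)) s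

    L-++⁻ʳ : ∀ {π ρ t s} → L π t → L ρ t → L (π ++ ρ) s → L ρ s
    L-++⁻ʳ {π} {ρ} {t} {s} tπ tρ = proj₂ ∘′ proj₁ (axC π ρ (t , tπ , tρ)) s

  module Betweenness (axB : AxiomB G C) (axC : AxiomC G C) where
    open Consistency axC

    L-pair : ∀ {a b t} → I G a b t → L (a ∷ b ∷ []) t
    L-pair {a} {b} {t} = proj₂ (axB a b) t

    L-[_]⁻ : ∀ a {s} → L (a ∷ []) s → s ≡ a
    L-[ a ]⁻ {s} sa = sym (d≡0⇒≡ (m+n≡0⇒m≡0 (d a s) (trans a-s-a (d-refl a))))
      where
      a-s-a : I G a a s
      a-s-a = proj₁ (axB a a) s (L-++⁺ sa sa)

    L-[_] : ∀ a → L (a ∷ []) a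
    L-[ a ] with nonempty (a ∷ [])
    ... | s , sa = subst (L (a ∷ [])) (L-[ a ]⁻ sa) sa

    L-replicate : ∀ k a → L (replicate (suc k) a) a
    L-replicate zero    a = L-[ a ]
    L-replicate (suc k) a = L-++⁺ L-[ a ] (L-replicate k a)

    L-replicate⁻ : ∀ k a {s} → L (replicate (suc k) a) s → s ≡ a
    L-replicate⁻ zero    a = L-[ a ]⁻
    L-replicate⁻ (suc k) a = L-[ a ]⁻ ∘′ L-++⁻ˡ L-[ a ] (L-replicate k a)

  module Exchange (axA : AxiomA G C) (axC : AxiomC G C) where
    open Anonymity axA
    open Consistency axC

    L-exchange : ∀ {x a b c y t s} →
      L (x ∷ a ∷ b ∷ []) t → L (c ∷ y ∷ []) t →
      L (c ∷ a ∷ b ∷ []) s → L (x ∷ y ∷ []) s → L (x ∷ a ∷ b ∷ []) s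
    L-exchange {x} {a} {b} {c} {y} tσ tcy scab sxy =
      L-++⁻ˡ tσ tcy (L-↭ regroup (L-++⁺ scab sxy))
      where
      regroup : c ∷ a ∷ b ∷ x ∷ y ∷ [] ↭ x ∷ a ∷ b ∷ c ∷ y ∷ []
      regroup = ↭-trans (shift x (c ∷ a ∷ b ∷ []) (y ∷ []))
                        (prep x (↭-sym (shift c (a ∷ b ∷ []) (y ∷ []))))

module TriangleConsensus (G : Graph) (tc : TriangleCondition G) (C : ConsensusFunction G)
  (axA : AxiomA G C) (axB : AxiomB G C) (axC : AxiomC G C) (axT : AxiomT G C) where
  open Graph G
  open ConsensusFunction C
  open Distance G
  open Consensus G C
  open Anonymity axA
  open Consistency axC
  open Betweenness axB axC
  open Exchange axA axC

  L-swap₂₃ : ∀ {x a b t} → L (x ∷ a ∷ b ∷ []) t → L (x ∷ b ∷ a ∷ []) t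
  L-swap₂₃ {x} {a} {b} = L-↭ (prep x (swap a b ↭-refl))

  common-neighbour⇒endpoint : ∀ {x a b c} → c ~ a → c ~ b → a ~ b →
    L (x ∷ a ∷ b ∷ []) c → L (x ∷ a ∷ b ∷ []) a
  common-neighbour⇒endpoint {a = a} c~a c~b a~b cσ =
    L-exchange cσ (L-pair a∈I) (proj₂ (axT _ _ _ c~a a~b c~b) a (inj₂ (inj₁ refl))) (L-pair b∈I)

  nearer-member⇒endpoint : ∀ {x a b z} → a ~ b → d z a < d z b →
    L (x ∷ a ∷ b ∷ []) z → L (x ∷ a ∷ b ∷ []) a
  nearer-member⇒endpoint {z = z} a~b lt zσ =
    L-++⁻ˡ zσ L-[ z ] (L-++⁺ (L-pair b∈I) (L-pair (I-sym (nearer-∈I a~b lt))))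

  equidistant-member⇒endpoint : ∀ {x a b z} → a ~ b → d z a ≡ d z b →
    L (x ∷ a ∷ b ∷ []) z → L (x ∷ a ∷ b ∷ []) a
  equidistant-member⇒endpoint {x} {a} {b} {z} a~b eq zσ
    with closer-common-neighbour tc a~b eq
  ... | w , w~a , w~b , closer = common-neighbour⇒endpoint w~a w~b a~b wσ
    where
    regroup : x ∷ w ∷ z ∷ a ∷ z ∷ b ∷ [] ↭ x ∷ a ∷ b ∷ w ∷ z ∷ z ∷ []
    regroup = prep x (↭-trans (shift a (w ∷ z ∷ []) (z ∷ b ∷ []))
                              (prep a (shift b (w ∷ z ∷ z ∷ []) [])))
    wσ : L (x ∷ a ∷ b ∷ []) w
    wσ = L-++⁻ˡ zσ (L-++⁺ {w ∷ z ∷ []} (L-pair b∈I) L-[ z ])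
           (L-↭ regroup (L-++⁺ {x ∷ w ∷ []} (L-pair b∈I)
             (L-++⁺ {z ∷ a ∷ []} (L-pair (closer-∈I w~a closer))
                                 (L-pair (closer-∈I w~b (trans closer eq))))))

  -- Take any z ∈ L(x,a,b).  If z is nearer to a, consistency with L(z) = {z} already gives a;
  -- otherwise some common neighbour of a and b lies in L(x,a,b), and (T) then pulls a in.
  equidistant-endpoint : ∀ {x a b} → a ~ b → d x a ≡ d x b → L (x ∷ a ∷ b ∷ []) a
  equidistant-endpoint {x} {a} {b} a~b eq
    with closer-common-neighbour tc a~b eq | nonempty (x ∷ a ∷ b ∷ [])
  ... | w , w~a , w~b , closer | z , zσ with <-cmp (d z a) (d z b)
  ... | tri< lt _ _ = nearer-member⇒endpoint a~b lt zσ
  ... | tri≈ _ e _  = equidistant-member⇒endpoint a~b e zσ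
  ... | tri> _ _ gt = common-neighbour⇒endpoint w~a w~b a~b wσ
    where
    bσ : L (x ∷ a ∷ b ∷ []) b
    bσ = L-swap₂₃ (nearer-member⇒endpoint (~-sym a~b) gt (L-swap₂₃ zσ))
    wσ : L (x ∷ a ∷ b ∷ []) w
    wσ = L-exchange bσ (L-pair b∈I) (proj₂ (axT _ _ _ w~a a~b w~b) w (inj₁ refl))
                    (L-pair (closer-∈I w~b (trans closer eq)))

  module Edge (u v : V) (u~v : u ~ v) where
    open Blocks u v

    Both : Profile G → Set
    Both ρ = L ρ u × L ρ v

    balanced-block : ∀ n {t} → I G u v t → L (block (suc n) (suc n)) t
    balanced-block zero    t∈I = L-pair t∈I
    balanced-block (suc n) t∈I =
      L-↭ (block-absorb 1 1 [] (suc n) (suc n)) (L-++⁺ (L-pair t∈I) (balanced-block n t∈I))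

    surplus-block : ∀ {m n} → n < m →
      L (block (suc m) (suc n)) u × (∀ {s} → L (block (suc m) (suc n)) s → s ≡ u)
    surplus-block {n = n} n<m with m≤n⇒∃[o]m+o≡n n<m
    ... | k , refl = L-↭ split (L-++⁺ uᵏ (balanced-block n a∈I)) ,
                     L-replicate⁻ k u ∘′ L-↭ (↭-reflexive (List.++-identityʳ _)) ∘′
                       L-++⁻ˡ uᵏ (balanced-block n a∈I) ∘′ L-↭ (↭-sym split)
      where
      split : block (suc k) 0 ++ block (suc n) (suc n) ↭ block (suc (suc n + k)) (suc n)
      split = ↭-trans (block-absorb (suc k) 0 [] (suc n) (suc n))
                      (↭-reflexive (cong (λ j → block (suc j) (suc n)) (+-comm k (suc n))))
      uᵏ : L (block (suc k) 0) u
      uᵏ = L-↭ (↭-reflexive (sym (List.++-identityʳ _))) (L-replicate k u)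

    ballot : ∀ y → ∃₂ λ a b → d u y + b ≡ d v y + a × Both (y ∷ block a b)
    ballot y with <-cmp (d y u) (d y v)
    ... | tri< lt _ _ = 0 , 1 , trans (nearer-+1 u~v lt) (sym (+-identityʳ _)) ,
                        L-pair (nearer-∈I u~v lt) , L-pair b∈I
    ... | tri≈ _ e _  = 1 , 1 , cong (_+ 1) (trans (d-sym u y) (trans e (d-sym y v))) ,
                        equidistant-endpoint u~v e ,
                        L-swap₂₃ (equidistant-endpoint (~-sym u~v) (sym e))
    ... | tri> _ _ gt = 1 , 0 , trans (+-identityʳ _) (sym (nearer-+1 (~-sym u~v) gt)) ,
                        L-pair b∈I , L-pair (nearer-∈I (~-sym u~v) gt)

    compensation : ∀ π → ∃₂ λ m n →
      F G π u + n ≡ F G π v + m × Both (π ++ block (suc m) (suc n))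
    compensation [] = 0 , 0 , refl , L-pair a∈I , L-pair b∈I
    compensation (y ∷ π) with ballot y | compensation π
    ... | a , b , eqʸ , uʸ , vʸ | m , n , eqᵖ , uᵖ , vᵖ =
      a + m , b + n , +-interchange-≡ (d u y) (d v y) (F G π u) (F G π v) eqʸ eqᵖ ,
      L-↭ merge (L-++⁺ uʸ uᵖ) , L-↭ merge (L-++⁺ vʸ vᵖ)
      where
      merge : (y ∷ block a b) ++ π ++ block (suc m) (suc n) ↭
              (y ∷ π) ++ block (suc (a + m)) (suc (b + n))
      merge = prep y (↭-trans (block-absorb a b π (suc m) (suc n))
                              (↭-reflexive (cong (π ++_) (cong₂ block (+-suc a m) (+-suc b n)))))

    F≡F⇒u∈L⇒v∈L : ∀ π → F G π u ≡ F G π v → L π u → L π v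
    F≡F⇒u∈L⇒v∈L π Fu≡Fv uπ with compensation π
    ... | m , n , eq , _ , vᶜ
      with +-cancelˡ-≡ (F G π v) n m (trans (cong (_+ n) (sym Fu≡Fv)) eq)
    ... | refl = L-++⁻ˡ uπ (balanced-block n a∈I) vᶜ

    F>F⇒u∉L : ∀ π → F G π u > F G π v → ¬ L π u
    F>F⇒u∉L π Fu>Fv uπ with compensation π
    ... | m , n , eq , _ , vᶜ = ~-irr (subst (u ~_) v≡u u~v)
      where
      open ≤-Reasoning
      n<m : n < m
      n<m = +-cancelˡ-< (F G π v) n m (begin-strict
        F G π v + n <⟨ +-monoˡ-< n Fu>Fv ⟩
        F G π u + n ≡⟨ eq ⟩
        F G π v + m ∎)
      v≡u : v ≡ u
      v≡u = proj₂ (surplus-block n<m) (L-++⁻ʳ uπ (proj₁ (surplus-block n<m)) vᶜ)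

lemma9 : (G : Graph) → TriangleCondition G →
    (C : ConsensusFunction G) →
    AxiomA G C → AxiomB G C → AxiomC G C → AxiomT G C →
    (π : Profile G) → (u v : Graph.V G) → Graph._~_ G u v →
    ((F G π u ≡ F G π v →
        ((ConsensusFunction.L C π u → ConsensusFunction.L C π v) ×
         (ConsensusFunction.L C π v → ConsensusFunction.L C π u)))
     × (F G π u > F G π v → ¬ ConsensusFunction.L C π u))
lemma9 G tc C axA axB axC axT π u v u~v =
  (λ Fu≡Fv → Edge.F≡F⇒u∈L⇒v∈L u v u~v π Fu≡Fv ,
             Edge.F≡F⇒u∈L⇒v∈L v u (Graph.~-sym G u~v) π (sym Fu≡Fv)) ,
  Edge.F>F⇒u∉L u v u~v π
  where open TriangleConsensus G tc C axA axB axC axT
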